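{- Let $G$ be a connected graph of order $n\geq 4$ and size $m$. Then \[ \chi_d^t(\overline{C(G)})=\begin{cases} n & \text{if } G \text{ is a tree},\\ m & \text{otherwise},\end{cases} \] where $\overline{C(G)}$ denotes the complement of $C(G)$.
   Context: All graphs are finite, simple and undirected; the size of a graph is its number of edges. For a graph $G=(V,E)$ with $V=\{v_1,\dots,v_n\}$, the central graph $C(G)$ is the graph with vertex set $V\cup\{c_{ij} : v_iv_j\in E\}$ obtained by subdividing each edge $v_iv_j$ of $G$ exactly once by a new vertex $c_{ij}$ (adjacent to exactly $v_i$ and $v_j$) and joining every pair of distinct vertices non-adjacent in $G$. A total dominator coloring (TDC) of a graph $H$ with no isolated vertices is a proper vertex coloring of $H$ in which every vertex is adjacent to all vertices of some color class. $\chi_d^t(H)$ is the minimum number of color classes in a TDC of $H$. -}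

module Defs where

open import Data.Nat using (ℕ; suc; _≤_; _∸_)
open import Data.Bool using (Bool; true; false; T; not)
open import Data.Fin using (Fin; zero; suc; inject₁; fromℕ; _<_)
open import Data.Sum using (_⊎_; inj₁; inj₂)
open import Data.Product using (Σ; ∃; _×_; _,_; proj₁; proj₂)
open import Data.Empty using (⊥)
open import Relation.Nullary using (¬_)
open import Relation.Binary.PropositionalEquality using (_≡_; _≢_)
open import Function.Definitions using (Injective; Surjective)
open import Function.Bundles using (_↔_)

record SimpleGraph (n : ℕ) : Set where
  field
    Adj    : Fin n → Fin n → Bool
    sym    : ∀ i j → Adj i j ≡ Adj j i
    irrefl : ∀ i → Adj i i ≡ false
open SimpleGraph public

module _ {n : ℕ} (G : SimpleGraph n) where

  -- Edges of G: unordered pairs {i,j}, represented as i < j with i ~ j.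
  Edge : Set
  Edge = Σ (Fin n) λ i → Σ (Fin n) λ j → (i < j) × T (Adj G i j)

  HasSize : ℕ → Set
  HasSize m = Edge ↔ Fin m

  data Walk : Fin n → Fin n → Set where
    here : ∀ {u} → Walk u u
    step : ∀ {u v w} → T (Adj G u v) → Walk v w → Walk u w

  Connected : Set
  Connected = ∀ u v → Walk u v

  -- A cycle of length k+3: distinct vertices f 0, …, f (k+2), consecutive ones
  -- adjacent and the last adjacent to the first.
  record Cycle (k : ℕ) : Set where
    field
      f      : Fin (suc (suc (suc k))) → Fin n
      inj    : Injective _≡_ _≡_ f
      consec : ∀ (i : Fin (suc (suc k))) → T (Adj G (f (inject₁ i)) (f (suc i)))
      close  : T (Adj G (f (fromℕ (suc (suc k)))) (f zero))

  Acyclic : Set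
  Acyclic = ∀ k → ¬ Cycle k

  IsTree : Set
  IsTree = Connected × Acyclic

  -- Vertices of the central graph C(G): original vertices v_i and subdivision vertices c_e.
  CVertex : Set
  CVertex = Fin n ⊎ Edge

  CAdj : CVertex → CVertex → Set
  CAdj (inj₁ i) (inj₁ j) = i ≢ j × T (not (Adj G i j))
  CAdj (inj₁ i) (inj₂ (a , b , _)) = (i ≡ a) ⊎ (i ≡ b)     -- subdivision edge
  CAdj (inj₂ (a , b , _)) (inj₁ i) = (i ≡ a) ⊎ (i ≡ b)
  CAdj (inj₂ _) (inj₂ _) = ⊥

  CompCAdj : CVertex → CVertex → Set
  CompCAdj u v = u ≢ v × ¬ CAdj u v

-- Total dominator coloring with exactly k (nonempty) color classes of a graph
-- with vertex type V and adjacency relation Adj.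
record TDC {V : Set} (Adj : V → V → Set) (k : ℕ) : Set where
  field
    col      : V → Fin k
    onto     : ∀ (i : Fin k) → ∃ λ v → col v ≡ i
    proper   : ∀ u v → Adj u v → col u ≢ col v
    dominate : ∀ v → ∃ λ (i : Fin k) → ∀ w → col w ≡ i → Adj v w

-- χ_d^t(H) = k : a TDC with k classes exists and none with fewer classes.
TDChromatic : {V : Set} → (V → V → Set) → ℕ → Set
TDChromatic Adj k = TDC Adj k × (∀ j → j Data.Nat.< k → ¬ TDC Adj j)

-- In the complement H of C(G) two original vertices are adjacent iff they are adjacent in G,
-- v and c_e are adjacent iff v ∉ e, and the c_e form a clique, so every TDC needs m colours.
-- Colouring v like c_e(v), for an injective choice v ∈ e(v), gives a TDC with m colours; such a
-- choice is the same as a map v ↦ out v along edges without 2-cycles.  Iterating such a map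
-- closes a cycle, so for a tree a TDC must give some vertex a colour shared by no c_e, and that
-- colour with the distinct colours of the n - 1 parent edges of a breadth-first tree shows that
-- n colours are needed; colouring each c_e by its lower end attains n.  Conversely, when G has
-- a cycle some edge ab lies outside the breadth-first tree, and reversing the tree path from a
-- to the root while sending a to b gives the map.

module Submission where

open import Defs hiding (sym)
open import Data.Nat using (ℕ; zero; suc; _≤_; _<_; _∸_; _+_; z≤n; s≤s; s<s; _≤?_; _≟_)
open import Data.Nat.Properties hiding (_≟_)
open import Data.Bool using (true; false; T; not)
open import Data.Bool.Properties using (T-irrelevant)
open import Data.Unit using (tt)
open import Data.Fin as F using (Fin; zero; suc; toℕ; inject₁; fromℕ; fromℕ<; lower₁; _↑ˡ_)
open import Data.Fin.Properties
  using (toℕ-injective; any?; all?; ¬∀⟶∃¬; ¬∀⟶∃¬-smallest; pigeonhole; injective⇒≤;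
         toℕ-fromℕ; toℕ-inject₁; toℕ-lower₁; ↑ˡ-injective; inject₁-lower₁; toℕ<n; toℕ-fromℕ<;
         toℕ-inject)
  renaming (_≟_ to _≟ᶠ_; <-cmp to <-cmpᶠ)
open import Data.Vec using (_∷_; []; lookup)
open import Data.Sum using (_⊎_; inj₁; inj₂)
open import Data.Product using (Σ; ∃; _×_; _,_; proj₁; proj₂)
open import Data.Empty using (⊥-elim)
open import Relation.Nullary using (¬_; Dec; yes; no; ¬?)
open import Relation.Nullary.Decidable using (T?; decidable-stable; _×-dec_; _⊎-dec_; _→-dec_)
open import Relation.Unary using (Decidable)
open import Relation.Binary.PropositionalEquality
open import Relation.Binary.Definitions using (tri<; tri≈; tri>)
open import Function using (_∘_)
open import Function.Bundles using (Inverse)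

record Minimal (P : ℕ → Set) : Set where
  field
    value   : ℕ
    holds   : P value
    minimal : ∀ {j} → j < value → ¬ P j

minimal : ∀ {P : ℕ → Set} → Decidable P → ∀ {N} → P N → Minimal P
minimal {P} P? {N} pN with ¬∀⟶∃¬-smallest (suc N) (λ i → ¬ P (toℕ i)) (λ i → ¬? (P? (toℕ i)))
                             (λ none → none (fromℕ N) (subst P (sym (toℕ-fromℕ N)) pN))
... | i , ¬¬p , below = record
  { value   = toℕ i
  ; holds   = decidable-stable (P? (toℕ i)) ¬¬p
  ; minimal = λ j<i pj → below (fromℕ< j<i) (subst P (sym (trans (toℕ-inject _) (toℕ-fromℕ< j<i))) pj)
  }

n≢2+n : ∀ k → k ≢ suc (suc k)
n≢2+n k = <⇒≢ (<-trans (n<1+n k) (n<1+n (suc k)))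

argmax : ∀ {k} (h : Fin (suc k) → ℕ) → Σ (Fin (suc k)) λ i → ∀ j → h j ≤ h i
argmax {zero} h = zero , λ { zero → ≤-refl }
argmax {suc k} h with argmax (h ∘ suc)
... | i , hi with h zero ≤? h (suc i)
... | yes le = suc i , λ { zero → le ; (suc j) → hi j }
... | no nle = zero , λ { zero → ≤-refl ; (suc j) → ≤-trans (hi j) (<⇒≤ (≰⇒> nle)) }

outside-image : ∀ {k n} → k < n → (f : Fin k → Fin n) → ∃ λ v → ∀ i → f i ≢ v
outside-image {k} {n} k<n f with all? (λ v → any? (λ i → f i ≟ᶠ v))
... | yes covered = ⊥-elim (<⇒≱ k<n (injective⇒≤ preimage-injective))
  where
  preimage-injective : ∀ {v w} → proj₁ (covered v) ≡ proj₁ (covered w) → v ≡ w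
  preimage-injective {v} {w} eq = trans (sym (proj₂ (covered v))) (trans (cong f eq) (proj₂ (covered w)))
... | no ¬covered with ¬∀⟶∃¬ n _ (λ v → any? (λ i → f i ≟ᶠ v)) ¬covered
...   | v , uncovered = v , λ i fi≡v → uncovered (i , fi≡v)

avoid₂ : ∀ {n} → 2 < n → (a b : Fin n) → ∃ λ v → v ≢ a × v ≢ b
avoid₂ 2<n a b with outside-image 2<n (lookup (a ∷ b ∷ []))
... | v , ∉ab = v , (∉ab zero ∘ sym) , (∉ab (suc zero) ∘ sym)

avoid₃ : ∀ {n} → 3 < n → (a b c : Fin n) → ∃ λ v → v ≢ a × v ≢ b × v ≢ c
avoid₃ 3<n a b c with outside-image 3<n (lookup (a ∷ b ∷ c ∷ []))
... | v , ∉abc = v , (∉abc zero ∘ sym) , (∉abc (suc zero) ∘ sym) , (∉abc (suc (suc zero)) ∘ sym)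

module Graph {n : ℕ} (G : SimpleGraph n) where
  V : Set
  V = Fin n

  _~_ : V → V → Set
  u ~ v = T (Adj G u v)

  _~?_ : ∀ u v → Dec (u ~ v)
  u ~? v = T? (Adj G u v)

  ~-sym : ∀ {u v} → u ~ v → v ~ u
  ~-sym {u} {v} = subst T (SimpleGraph.sym G u v)

  ~-irrefl : ∀ {u v} → u ~ v → u ≢ v
  ~-irrefl {u} u~u refl with Adj G u u | SimpleGraph.irrefl G u
  ~-irrefl {u} () refl | .false | refl

  E : Set
  E = Edge G

  lo hi : E → V
  lo = proj₁
  hi = proj₁ ∘ proj₂

  lo<hi : ∀ e → lo e F.< hi e
  lo<hi = proj₁ ∘ proj₂ ∘ proj₂

  lo~hi : ∀ e → lo e ~ hi e
  lo~hi = proj₂ ∘ proj₂ ∘ proj₂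

  _∈ₑ_ : V → E → Set
  v ∈ₑ e = v ≡ lo e ⊎ v ≡ hi e

  _∈ₑ?_ : ∀ v e → Dec (v ∈ₑ e)
  v ∈ₑ? e = (v ≟ᶠ lo e) ⊎-dec (v ≟ᶠ hi e)

  edge-≡ : ∀ {e f} → lo e ≡ lo f → hi e ≡ hi f → e ≡ f
  edge-≡ {a , b , a<b , a~b} {.a , .b , a<b′ , a~b′} refl refl
    rewrite <-irrelevant a<b a<b′ | T-irrelevant a~b a~b′ = refl

  ∈ₑ-endpoints : ∀ {a b w e} → a ∈ₑ e → b ∈ₑ e → a ≢ b → w ∈ₑ e → w ≡ a ⊎ w ≡ b
  ∈ₑ-endpoints (inj₁ a≡) (inj₁ b≡) a≢b _ = ⊥-elim (a≢b (trans a≡ (sym b≡)))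
  ∈ₑ-endpoints (inj₂ a≡) (inj₂ b≡) a≢b _ = ⊥-elim (a≢b (trans a≡ (sym b≡)))
  ∈ₑ-endpoints (inj₁ a≡) (inj₂ b≡) _ (inj₁ w≡) = inj₁ (trans w≡ (sym a≡))
  ∈ₑ-endpoints (inj₁ a≡) (inj₂ b≡) _ (inj₂ w≡) = inj₂ (trans w≡ (sym b≡))
  ∈ₑ-endpoints (inj₂ a≡) (inj₁ b≡) _ (inj₁ w≡) = inj₂ (trans w≡ (sym b≡))
  ∈ₑ-endpoints (inj₂ a≡) (inj₁ b≡) _ (inj₂ w≡) = inj₁ (trans w≡ (sym a≡))

  edge-determined : ∀ {u v e f} → u ≢ v → u ∈ₑ e → v ∈ₑ e → u ∈ₑ f → v ∈ₑ f → e ≡ f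
  edge-determined u≢v (inj₁ ue) (inj₁ ve) _ _ = ⊥-elim (u≢v (trans ue (sym ve)))
  edge-determined u≢v (inj₂ ue) (inj₂ ve) _ _ = ⊥-elim (u≢v (trans ue (sym ve)))
  edge-determined u≢v _ _ (inj₁ uf) (inj₁ vf) = ⊥-elim (u≢v (trans uf (sym vf)))
  edge-determined u≢v _ _ (inj₂ uf) (inj₂ vf) = ⊥-elim (u≢v (trans uf (sym vf)))
  edge-determined _ (inj₁ ue) (inj₂ ve) (inj₁ uf) (inj₂ vf) = edge-≡ (trans (sym ue) uf) (trans (sym ve) vf)
  edge-determined _ (inj₂ ue) (inj₁ ve) (inj₂ uf) (inj₁ vf) = edge-≡ (trans (sym ve) vf) (trans (sym ue) uf)
  edge-determined {e = e} {f} _ (inj₁ refl) (inj₂ refl) (inj₂ uf) (inj₁ vf) =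
    ⊥-elim (<-asym (lo<hi e) (subst₂ F._<_ (sym vf) (sym uf) (lo<hi f)))
  edge-determined {e = e} {f} _ (inj₂ refl) (inj₁ refl) (inj₁ uf) (inj₂ vf) =
    ⊥-elim (<-asym (lo<hi e) (subst₂ F._<_ (sym uf) (sym vf) (lo<hi f)))

  edge : ∀ u v → u ~ v → E
  edge u v u~v with <-cmpᶠ u v
  ... | tri< u<v _ _ = u , v , u<v , u~v
  ... | tri≈ _ u≡v _ = ⊥-elim (~-irrefl u~v u≡v)
  ... | tri> _ _ v<u = v , u , v<u , ~-sym u~v

  ∈ₑ-edgeˡ : ∀ u v (u~v : u ~ v) → u ∈ₑ edge u v u~v
  ∈ₑ-edgeˡ u v u~v with <-cmpᶠ u v
  ... | tri< _ _ _ = inj₁ refl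
  ... | tri≈ _ u≡v _ = ⊥-elim (~-irrefl u~v u≡v)
  ... | tri> _ _ _ = inj₂ refl

  ∈ₑ-edgeʳ : ∀ u v (u~v : u ~ v) → v ∈ₑ edge u v u~v
  ∈ₑ-edgeʳ u v u~v with <-cmpᶠ u v
  ... | tri< _ _ _ = inj₂ refl
  ... | tri≈ _ u≡v _ = ⊥-elim (~-irrefl u~v u≡v)
  ... | tri> _ _ _ = inj₁ refl

  ∈ₑ-edge⁻ : ∀ {u v w} (u~v : u ~ v) → w ∈ₑ edge u v u~v → w ≡ u ⊎ w ≡ v
  ∈ₑ-edge⁻ {u} {v} u~v = ∈ₑ-endpoints {e = edge u v u~v} (∈ₑ-edgeˡ u v u~v) (∈ₑ-edgeʳ u v u~v) (~-irrefl u~v)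

  edge-≡⁻ : ∀ {u v u′ v′} (u~v : u ~ v) (u′~v′ : u′ ~ v′) →
            edge u v u~v ≡ edge u′ v′ u′~v′ → u ≡ u′ ⊎ (u ≡ v′ × v ≡ u′)
  edge-≡⁻ {u} {v} u~v u′~v′ eq
    with ∈ₑ-edge⁻ u′~v′ (subst (u ∈ₑ_) eq (∈ₑ-edgeˡ _ _ u~v))
       | ∈ₑ-edge⁻ u′~v′ (subst (v ∈ₑ_) eq (∈ₑ-edgeʳ _ _ u~v))
  ... | inj₁ u≡u′ | _ = inj₁ u≡u′
  ... | inj₂ u≡v′ | inj₁ v≡u′ = inj₂ (u≡v′ , v≡u′)
  ... | inj₂ u≡v′ | inj₂ v≡v′ = ⊥-elim (~-irrefl u~v (trans u≡v′ (sym v≡v′)))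

  opposite : V → E → V
  opposite v e with v ≟ᶠ lo e
  ... | yes _ = hi e
  ... | no _ = lo e

  ~-opposite : ∀ {v e} → v ∈ₑ e → v ~ opposite v e
  ~-opposite {v} {e} v∈e with v ≟ᶠ lo e | v∈e
  ... | yes refl | _ = lo~hi e
  ... | no v≢lo | inj₁ v≡lo = ⊥-elim (v≢lo v≡lo)
  ... | no _ | inj₂ refl = ~-sym (lo~hi e)

  opposite-∈ₑ : ∀ v e → opposite v e ∈ₑ e
  opposite-∈ₑ v e with v ≟ᶠ lo e
  ... | yes _ = inj₂ refl
  ... | no _ = inj₁ refl

  ~⇒compl : ∀ {u v} → u ~ v → CompCAdj G (inj₁ u) (inj₁ v)
  ~⇒compl {u} {v} u~v = (λ { refl → ~-irrefl u~v refl }) , λ { (_ , u≁v) → not-T (Adj G u v) u~v u≁v }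
    where
    not-T : ∀ b → T b → ¬ T (not b)
    not-T true _ ()

  compl⇒~ : ∀ {u v} → CompCAdj G (inj₁ u) (inj₁ v) → u ~ v
  compl⇒~ {u} {v} (u≢v , ¬cadj) with Adj G u v
  ... | true = tt
  ... | false = ⊥-elim (¬cadj ((λ { refl → u≢v refl }) , tt))

  ∉⇒complᵛᵉ : ∀ {v e} → ¬ v ∈ₑ e → CompCAdj G (inj₁ v) (inj₂ e)
  ∉⇒complᵛᵉ v∉e = (λ ()) , v∉e

  ∉⇒complᵉᵛ : ∀ {v e} → ¬ v ∈ₑ e → CompCAdj G (inj₂ e) (inj₁ v)
  ∉⇒complᵉᵛ v∉e = (λ ()) , v∉e

  ≢⇒complᵉᵉ : ∀ {e f} → e ≢ f → CompCAdj G (inj₂ e) (inj₂ f)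
  ≢⇒complᵉᵉ e≢f = (λ { refl → e≢f refl }) , λ ()

  cycle-neighbours : ∀ {k} (C : Cycle G k) i → let open Cycle C in
    Σ (Fin (suc (suc (suc k)))) λ j₁ → Σ (Fin (suc (suc (suc k)))) λ j₂ →
      j₁ ≢ j₂ × f j₁ ~ f i × f j₂ ~ f i
  cycle-neighbours {k} C zero = suc zero , fromℕ (suc (suc k)) , (λ ()) , ~-sym (Cycle.consec C zero) , Cycle.close C
  cycle-neighbours {k} C (suc i) with toℕ i ≟ suc k
  ... | yes i≡last = inject₁ i , zero , inject₁i≢0 , consec i , ~-sym (subst (λ z → f z ~ f zero) last≡ close)
    where
    open Cycle C
    last≡ : fromℕ (suc (suc k)) ≡ suc i
    last≡ = cong suc (toℕ-injective (trans (toℕ-fromℕ (suc k)) (sym i≡last)))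
    inject₁i≢0 : inject₁ i ≢ zero
    inject₁i≢0 eq with trans (sym i≡last) (trans (sym (toℕ-inject₁ i)) (cong toℕ eq))
    ... | ()
  ... | no i≢last = inject₁ i , suc (suc i′) , inject₁i≢ , consec i ,
                    subst (λ z → f (suc (suc i′)) ~ f (suc z)) (inject₁-lower₁ i (i≢last ∘ sym))
                          (~-sym (consec (suc i′)))
    where
    open Cycle C
    i′ : Fin (suc k)
    i′ = lower₁ i (i≢last ∘ sym)
    inject₁i≢ : inject₁ i ≢ suc (suc i′)
    inject₁i≢ eq = <-irrefl (trans (trans (sym (toℕ-inject₁ i)) (cong toℕ eq))
                                   (cong (2 +_) (toℕ-lower₁ i (i≢last ∘ sym))))
                            (n≤1+n _)

  nonAdjacentPair : 2 < n → Acyclic G → Σ V λ u → Σ V λ w → u ≢ w × ¬ u ~ w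
  nonAdjacentPair (s≤s (s≤s (s≤s _))) acyclic
    with zero ~? suc zero | suc zero ~? suc (suc zero) | suc (suc zero) ~? zero
  ... | no ≁ | _ | _ = zero , suc zero , (λ ()) , ≁
  ... | yes _ | no ≁ | _ = suc zero , suc (suc zero) , (λ ()) , ≁
  ... | yes _ | yes _ | no ≁ = suc (suc zero) , zero , (λ ()) , ≁
  ... | yes 0~1 | yes 1~2 | yes 2~0 = ⊥-elim (acyclic 0 record
    { f = _↑ˡ _ ; inj = ↑ˡ-injective _ _ _ ; consec = λ { zero → 0~1 ; (suc zero) → 1~2 } ; close = 2~0 })

  record FunctionalOrientation : Set where
    field
      out      : V → V
      ~-out    : ∀ v → v ~ out v
      out-out≢ : ∀ v → out (out v) ≢ v

  module Trail (O : FunctionalOrientation) (s : V) where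
    open FunctionalOrientation O

    trail : ℕ → V
    trail zero = s
    trail (suc t) = out (trail t)

    Revisits : ℕ → Set
    Revisits j = Σ (Fin j) λ i → trail (toℕ i) ≡ trail j

    trail-+suc : ∀ i t → trail (i + suc t) ≡ out (trail (i + t))
    trail-+suc i t = cong trail (+-suc i t)

    trail-+1 : ∀ i → trail (i + 1) ≡ out (trail i)
    trail-+1 i = trans (trail-+suc i 0) (cong (out ∘ trail) (+-identityʳ i))

    closedTrail⇒cycle : ∀ i k → trail i ≡ trail (i + suc (suc (suc k))) →
                        (∀ {j} → j < i + suc (suc (suc k)) → ¬ Revisits j) → Cycle G k
    closedTrail⇒cycle i k closed firstRevisit = record { f = g ; inj = g-injective ; consec = g-consec ; close = g-close }
      where
      g : Fin (suc (suc (suc k))) → V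
      g t = trail (i + toℕ t)
      g-distinct : ∀ t t′ → toℕ t < toℕ t′ → g t ≢ g t′
      g-distinct t t′ t<t′ eq = firstRevisit (+-monoʳ-< i (toℕ<n t′))
        (fromℕ< (+-monoʳ-< i t<t′) , trans (cong trail (toℕ-fromℕ< (+-monoʳ-< i t<t′))) eq)
      g-injective : ∀ {t t′} → g t ≡ g t′ → t ≡ t′
      g-injective {t} {t′} eq with <-cmp (toℕ t) (toℕ t′)
      ... | tri< t<t′ _ _ = ⊥-elim (g-distinct t t′ t<t′ eq)
      ... | tri≈ _ t≡t′ _ = toℕ-injective t≡t′
      ... | tri> _ _ t′<t = ⊥-elim (g-distinct t′ t t′<t (sym eq))
      g-consec : ∀ (t : Fin (suc (suc k))) → g (inject₁ t) ~ g (suc t)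
      g-consec t rewrite toℕ-inject₁ t | trail-+suc i (toℕ t) = ~-out (trail (i + toℕ t))
      g-close : g (fromℕ (suc (suc k))) ~ g zero
      g-close rewrite toℕ-fromℕ (suc (suc k)) | +-identityʳ i | closed | trail-+suc i (suc (suc k)) =
        ~-out (trail (i + suc (suc k)))

    closedTrail⇒Σcycle : ∀ i L → trail i ≡ trail (i + suc L) →
                         (∀ {j} → j < i + suc L → ¬ Revisits j) → Σ ℕ (Cycle G)
    closedTrail⇒Σcycle i zero closed _ =
      ⊥-elim (~-irrefl (~-out (trail i)) (trans closed (trail-+1 i)))
    closedTrail⇒Σcycle i (suc zero) closed _ =
      ⊥-elim (out-out≢ (trail i) (sym (trans closed (trans (trail-+suc i 1) (cong out (trail-+1 i))))))
    closedTrail⇒Σcycle i (suc (suc k)) closed firstRevisit = k , closedTrail⇒cycle i k closed firstRevisit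

    firstRevisit⇒cycle : Minimal Revisits → Σ ℕ (Cycle G)
    firstRevisit⇒cycle record { value = j ; holds = (i , revisit) ; minimal = below } =
      closedTrail⇒Σcycle (toℕ i) (j ∸ suc (toℕ i)) (trans revisit (cong trail (sym j≡)))
                         (λ lt → below (subst (_ <_) j≡ lt))
      where
      j≡ : toℕ i + suc (j ∸ suc (toℕ i)) ≡ j
      j≡ = trans (+-suc (toℕ i) _) (m+[n∸m]≡n (toℕ<n i))

    someRevisit : Σ ℕ Revisits
    someRevisit with pigeonhole (n<1+n n) (λ (t : Fin (suc n)) → trail (toℕ t))
    ... | t₁ , t₂ , t₁<t₂ , eq = toℕ t₂ , fromℕ< t₁<t₂ , trans (cong trail (toℕ-fromℕ< t₁<t₂)) eq

    cycle : Σ ℕ (Cycle G)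
    cycle = firstRevisit⇒cycle (minimal (λ j → any? (λ i → trail (toℕ i) ≟ᶠ trail j)) (proj₂ someRevisit))

  orientation⇒cycle : V → FunctionalOrientation → Σ ℕ (Cycle G)
  orientation⇒cycle s O = Trail.cycle O s

  record Rooting (r : V) : Set where
    field
      parent       : V → V
      depth        : V → ℕ
      parent-root  : parent r ≡ r
      depth-root   : depth r ≡ 0
      ~-parent     : ∀ {v} → v ≢ r → v ~ parent v
      depth-parent : ∀ {v} → v ≢ r → depth v ≡ suc (depth (parent v))

  module BreadthFirst (r : V) where
    data Reach : ℕ → V → Set where
      root : ∀ {k} → Reach k r
      step : ∀ {k u v} → v ~ u → Reach k u → Reach (suc k) v

    reach? : ∀ k v → Dec (Reach k v)
    reach? k v with v ≟ᶠ r
    reach? k v | yes refl = yes root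
    reach? zero v | no v≢r = no λ { root → v≢r refl }
    reach? (suc k) v | no v≢r with any? (λ u → (v ~? u) ×-dec reach? k u)
    ... | yes (u , v~u , reach-u) = yes (step v~u reach-u)
    ... | no ¬step = no λ { root → v≢r refl ; (step v~u reach-u) → ¬step (_ , v~u , reach-u) }

    walk⇒reach : ∀ {v} (w : Walk G v r) → Σ ℕ λ k → Reach k v
    walk⇒reach here = 0 , root
    walk⇒reach (step v~u w) = suc (proj₁ (walk⇒reach w)) , step v~u (proj₂ (walk⇒reach w))

    module _ (conn : Connected G) where
      distance : ∀ v → Minimal (λ k → Reach k v)
      distance v = minimal (λ k → reach? k v) (proj₂ (walk⇒reach (conn v r)))

      depth : V → ℕ
      depth v = Minimal.value (distance v)

      depth-minimal : ∀ {k v} → Reach k v → depth v ≤ k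
      depth-minimal {k} {v} reach = ≮⇒≥ (λ k<d → Minimal.minimal (distance v) k<d reach)

      step-down : ∀ {v k} → v ≢ r → Reach k v → Σ ℕ λ k′ → k ≡ suc k′ × Σ V λ u → v ~ u × Reach k′ u
      step-down v≢r root = ⊥-elim (v≢r refl)
      step-down _ (step v~u reach-u) = _ , refl , _ , v~u , reach-u

      parent-of : ∀ v → v ≢ r → Σ V λ u → v ~ u × depth v ≡ suc (depth u)
      parent-of v v≢r with step-down v≢r (Minimal.holds (distance v))
      ... | k , d≡ , u , v~u , reach-u = u , v~u , trans d≡ (cong suc (≤-antisym k≤du (depth-minimal reach-u)))
        where
        k≤du : k ≤ depth u
        k≤du = ≮⇒≥ λ du<k → <⇒≱ (subst (suc (depth u) <_) (sym d≡) (s<s du<k))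
                                (depth-minimal (step v~u (Minimal.holds (distance u))))

      parent-or-root : ∀ v → Dec (v ≡ r) → V
      parent-or-root v (yes _) = r
      parent-or-root v (no v≢r) = proj₁ (parent-of v v≢r)

      rooting : Rooting r
      rooting = record
        { parent       = parent
        ; depth        = depth
        ; parent-root  = parent-root (r ≟ᶠ r)
        ; depth-root   = n≤0⇒n≡0 (depth-minimal root)
        ; ~-parent     = λ {v} v≢r → ~-parent v≢r (v ≟ᶠ r)
        ; depth-parent = λ {v} v≢r → depth-parent v≢r (v ≟ᶠ r)
        }
        where
        parent : V → V
        parent v = parent-or-root v (v ≟ᶠ r)
        parent-root : (r≟r : Dec (r ≡ r)) → parent-or-root r r≟r ≡ r
        parent-root (yes _) = refl
        parent-root (no r≢r) = ⊥-elim (r≢r refl)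
        ~-parent : ∀ {v} → v ≢ r → (v≟r : Dec (v ≡ r)) → v ~ parent-or-root v v≟r
        ~-parent v≢r (yes v≡r) = ⊥-elim (v≢r v≡r)
        ~-parent {v} _ (no v≢r) = proj₁ (proj₂ (parent-of v v≢r))
        depth-parent : ∀ {v} → v ≢ r → (v≟r : Dec (v ≡ r)) → depth v ≡ suc (depth (parent-or-root v v≟r))
        depth-parent v≢r (yes v≡r) = ⊥-elim (v≢r v≡r)
        depth-parent {v} _ (no v≢r) = proj₂ (proj₂ (parent-of v v≢r))

  breadthFirstRooting : Connected G → (r : V) → Rooting r
  breadthFirstRooting conn r = BreadthFirst.rooting r conn

  module Rooted {r : V} (R : Rooting r) where
    open Rooting R

    depth≡0⇒root : ∀ {v} → depth v ≡ 0 → v ≡ r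
    depth≡0⇒root {v} d≡0 with v ≟ᶠ r
    ... | yes v≡r = v≡r
    ... | no v≢r = ⊥-elim (0≢1+n (trans (sym d≡0) (depth-parent v≢r)))

    depth≡suc⇒≢root : ∀ {v k} → depth v ≡ suc k → v ≢ r
    depth≡suc⇒≢root d≡suc refl = 0≢1+n (trans (sym depth-root) d≡suc)

    depth-parent∸1 : ∀ v → depth (parent v) ≡ depth v ∸ 1
    depth-parent∸1 v with v ≟ᶠ r
    ... | yes refl = trans (cong depth parent-root) (trans depth-root (cong (_∸ 1) (sym depth-root)))
    ... | no v≢r = cong (_∸ 1) (sym (depth-parent v≢r))

    parent-parent≡⇒root : ∀ {v} → parent (parent v) ≡ v → v ≡ r
    parent-parent≡⇒root {v} ppv≡v with v ≟ᶠ r | parent v ≟ᶠ r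
    ... | yes v≡r | _ = v≡r
    ... | no _ | yes pv≡r = trans (sym ppv≡v) (trans (cong parent pv≡r) parent-root)
    ... | no v≢r | no pv≢r = ⊥-elim (n≢2+n (depth v)
      (trans (depth-parent v≢r) (cong suc (trans (depth-parent pv≢r) (cong (suc ∘ depth) ppv≡v)))))

    TreeEdge : V → V → Set
    TreeEdge u v = parent u ≡ v ⊎ parent v ≡ u

    tree-edge? : ∀ u v → Dec (TreeEdge u v)
    tree-edge? u v = (parent u ≟ᶠ v) ⊎-dec (parent v ≟ᶠ u)

    parent≡⇒child : ∀ {u v} → u ~ v → parent u ≡ v → u ≢ r × depth u ≡ suc (depth v)
    parent≡⇒child {u} u~v pu≡v = u≢r , trans (depth-parent u≢r) (cong (suc ∘ depth) pu≡v)
      where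
      u≢r : u ≢ r
      u≢r refl = ~-irrefl u~v (trans (sym parent-root) pu≡v)

    -- A vertex of maximal depth on a cycle would need both of its cycle neighbours as parent.
    treeEdges⇒acyclic : (∀ u v → u ~ v → TreeEdge u v) → Acyclic G
    treeEdges⇒acyclic tree k C with argmax (depth ∘ Cycle.f C)
    ... | i , deepest with cycle-neighbours C i
    ... | j₁ , j₂ , j₁≢j₂ , j₁~i , j₂~i =
      j₁≢j₂ (Cycle.inj C (trans (sym (parent≡ j₁ j₁~i)) (parent≡ j₂ j₂~i)))
      where
      open Cycle C
      parent≡ : ∀ j → f j ~ f i → parent (f i) ≡ f j
      parent≡ j fj~fi with tree (f j) (f i) fj~fi
      ... | inj₂ pfi≡fj = pfi≡fj
      ... | inj₁ pfj≡fi = ⊥-elim (<⇒≱ (subst (depth (f i) <_) (sym (proj₂ (parent≡⇒child fj~fi pfj≡fi))) (n<1+n _))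
                                    (deepest j))

    parentEdge : ∀ {v} → v ≢ r → E
    parentEdge {v} v≢r = edge v (parent v) (~-parent v≢r)

    parentEdge-injective : ∀ {v w} (v≢r : v ≢ r) (w≢r : w ≢ r) → parentEdge v≢r ≡ parentEdge w≢r → v ≡ w
    parentEdge-injective v≢r w≢r eq with edge-≡⁻ (~-parent v≢r) (~-parent w≢r) eq
    ... | inj₁ v≡w = v≡w
    ... | inj₂ (v≡pw , pv≡w) = ⊥-elim (w≢r (parent-parent≡⇒root (trans (cong parent (sym v≡pw)) pv≡w)))

    ancestor : ℕ → V → V
    ancestor zero v = v
    ancestor (suc k) v = parent (ancestor k v)

    depth-ancestor : ∀ k v → depth (ancestor k v) ≡ depth v ∸ k
    depth-ancestor zero v = refl
    depth-ancestor (suc k) v = begin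
      depth (parent (ancestor k v)) ≡⟨ depth-parent∸1 (ancestor k v) ⟩
      depth (ancestor k v) ∸ 1      ≡⟨ cong (_∸ 1) (depth-ancestor k v) ⟩
      depth v ∸ k ∸ 1               ≡⟨ ∸-+-assoc (depth v) k 1 ⟩
      depth v ∸ (k + 1)             ≡⟨ cong (depth v ∸_) (+-comm k 1) ⟩
      depth v ∸ suc k               ∎
      where open ≡-Reasoning

    -- Reverse the path from a up to the root and send a across the non-tree edge to b;
    -- every other vertex keeps pointing to its parent.
    module Reorientation {a b : V} (a~b : a ~ b) (¬tree : ¬ TreeEdge a b) where
      OnPath : V → Set
      OnPath v = ancestor (depth a ∸ depth v) a ≡ v

      child : V → V
      child v = ancestor (depth a ∸ suc (depth v)) a

      onPath-root : OnPath r
      onPath-root = depth≡0⇒root (begin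
        depth (ancestor (depth a ∸ depth r) a) ≡⟨ depth-ancestor (depth a ∸ depth r) a ⟩
        depth a ∸ (depth a ∸ depth r)          ≡⟨ m∸[m∸n]≡n (subst (_≤ depth a) (sym depth-root) z≤n) ⟩
        depth r                                ≡⟨ depth-root ⟩
        0                                      ∎)
        where open ≡-Reasoning

      module _ {v} (onPath : OnPath v) (v≢a : v ≢ a) where
        depth<depth-a : depth v < depth a
        depth<depth-a = ≰⇒> λ da≤dv → v≢a (trans (sym onPath) (cong (λ k → ancestor k a) (m≤n⇒m∸n≡0 da≤dv)))

        parent-child : parent (child v) ≡ v
        parent-child = trans (cong (λ k → ancestor k a) (sym (+-∸-assoc 1 depth<depth-a))) onPath

        depth-child : depth (child v) ≡ suc (depth v)
        depth-child = trans (depth-ancestor (depth a ∸ suc (depth v)) a) (m∸[m∸n]≡n depth<depth-a)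

        onPath-child : OnPath (child v)
        onPath-child = cong (λ k → ancestor (depth a ∸ k) a) depth-child

        ~-child : v ~ child v
        ~-child = ~-sym (subst (child v ~_) parent-child (~-parent (depth≡suc⇒≢root depth-child)))

      data Position (v : V) : Set where
        start   : v ≡ a → Position v
        onPath  : v ≢ a → OnPath v → Position v
        offPath : ¬ OnPath v → Position v

      position : ∀ v → Position v
      position v with v ≟ᶠ a | ancestor (depth a ∸ depth v) a ≟ᶠ v
      ... | yes v≡a | _ = start v≡a
      ... | no v≢a | yes on = onPath v≢a on
      ... | no _ | no off = offPath off

      out′ : ∀ {v} → Position v → V
      out′ (start _) = b
      out′ {v} (onPath _ _) = child v
      out′ {v} (offPath _) = parent v

      out : V → V
      out v = out′ (position v)

      ~-out′ : ∀ {v} (p : Position v) → v ~ out′ p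
      ~-out′ (start refl) = a~b
      ~-out′ (onPath v≢a on) = ~-child on v≢a
      ~-out′ (offPath off) = ~-parent λ { refl → off onPath-root }

      out′-out≢ : ∀ {v} (p : Position v) → out (out′ p) ≢ v
      out′-out≢ (start refl) = from-b (position b)
        where
        from-b : (q : Position b) → out′ q ≢ a
        from-b (start b≡a) = ~-irrefl a~b ∘ sym
        from-b (onPath b≢a on) cb≡a = ¬tree (inj₁ (trans (cong parent (sym cb≡a)) (parent-child on b≢a)))
        from-b (offPath _) pb≡a = ¬tree (inj₂ pb≡a)
      out′-out≢ {v} (onPath v≢a on) = from-child (position (child v))
        where
        from-child : (q : Position (child v)) → out′ q ≢ v
        from-child (start cv≡a) b≡v =
          ¬tree (inj₁ (trans (cong parent (sym cv≡a)) (trans (parent-child on v≢a) (sym b≡v))))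
        from-child (onPath cv≢a on′) ccv≡v = n≢2+n (depth v)
          (trans (cong depth (sym ccv≡v)) (trans (depth-child on′ cv≢a) (cong suc (depth-child on v≢a))))
        from-child (offPath off) _ = off (onPath-child on v≢a)
      out′-out≢ {v} (offPath off) = from-parent (position (parent v))
        where
        from-parent : (q : Position (parent v)) → out′ q ≢ v
        from-parent (start pv≡a) b≡v = ¬tree (inj₂ (trans (cong parent b≡v) pv≡a))
        from-parent (onPath pv≢a on) cpv≡v = off (subst OnPath cpv≡v (onPath-child on pv≢a))
        from-parent (offPath _) ppv≡v = off (subst OnPath (sym (parent-parent≡⇒root ppv≡v)) onPath-root)

      orientation : FunctionalOrientation
      orientation = record
        { out = out ; ~-out = λ v → ~-out′ (position v) ; out-out≢ = λ v → out′-out≢ (position v) }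

    acyclic⇒treeEdges : Acyclic G → ∀ u v → u ~ v → TreeEdge u v
    acyclic⇒treeEdges acyclic u v u~v with tree-edge? u v
    ... | yes tree = tree
    ... | no ¬tree = ⊥-elim (acyclic _ (proj₂ (orientation⇒cycle r (Reorientation.orientation u~v ¬tree))))

    ¬acyclic⇒orientation : ¬ Acyclic G → FunctionalOrientation
    ¬acyclic⇒orientation ¬acyclic with all? (λ u → all? (λ v → (u ~? v) →-dec tree-edge? u v))
    ... | yes tree = ⊥-elim (¬acyclic (treeEdges⇒acyclic λ u v → tree u v))
    ... | no ¬tree with ¬∀⟶∃¬ n _ (λ u → all? (λ v → (u ~? v) →-dec tree-edge? u v)) ¬tree
    ... | u , ¬tree-u with ¬∀⟶∃¬ n _ (λ v → (u ~? v) →-dec tree-edge? u v) ¬tree-u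
    ... | v , ¬tree-uv with u ~? v
    ... | yes u~v = Reorientation.orientation u~v (λ tree → ¬tree-uv (λ _ → tree))
    ... | no u≁v = ⊥-elim (¬tree-uv (λ u~v → ⊥-elim (u≁v u~v)))

    twoBelowRoot : ∀ {w} → w ≢ r → ¬ w ~ r → Σ ℕ λ k → depth w ≡ suc (suc k)
    twoBelowRoot {w} w≢r w≁r with depth w in dw
    ... | zero = ⊥-elim (w≢r (depth≡0⇒root dw))
    ... | suc zero = ⊥-elim (w≁r (subst (w ~_) pw≡r (~-parent w≢r)))
      where
      pw≡r : parent w ≡ r
      pw≡r = depth≡0⇒root (suc-injective (trans (sym (depth-parent w≢r)) dw))
    ... | suc (suc k) = k , refl

    grandchild : ∀ {w} → w ≢ r → ¬ w ~ r → Σ V λ x → parent x ≢ r × parent (parent x) ≡ r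
    grandchild {w} w≢r w≁r with twoBelowRoot w≢r w≁r
    ... | k , dw = ancestor k w , px≢r , depth≡0⇒root (suc-injective (trans (sym (depth-parent px≢r)) dpx))
      where
      dx : depth (ancestor k w) ≡ 2
      dx = trans (depth-ancestor k w) (trans (cong (_∸ k) dw) (m+n∸n≡m 2 k))
      dpx : depth (parent (ancestor k w)) ≡ 1
      dpx = suc-injective (trans (sym (depth-parent (depth≡suc⇒≢root dx))) dx)
      px≢r : parent (ancestor k w) ≢ r
      px≢r = depth≡suc⇒≢root dpx

    module _ (tree : ∀ u v → u ~ v → TreeEdge u v) where
      lowerEnd′ : (e : E) → Dec (parent (lo e) ≡ hi e) → V
      lowerEnd′ e (yes _) = lo e
      lowerEnd′ e (no _) = hi e

      lowerEnd : E → V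
      lowerEnd e = lowerEnd′ e (parent (lo e) ≟ᶠ hi e)

      lowerEnd-spec : ∀ e → lowerEnd e ∈ₑ e × parent (lowerEnd e) ∈ₑ e × lowerEnd e ≢ r
      lowerEnd-spec e = spec (parent (lo e) ≟ᶠ hi e)
        where
        spec : (lo≟hi : Dec (parent (lo e) ≡ hi e)) →
               lowerEnd′ e lo≟hi ∈ₑ e × parent (lowerEnd′ e lo≟hi) ∈ₑ e × lowerEnd′ e lo≟hi ≢ r
        spec (yes plo≡hi) = inj₁ refl , inj₂ plo≡hi , proj₁ (parent≡⇒child (lo~hi e) plo≡hi)
        spec (no plo≢hi) with tree (lo e) (hi e) (lo~hi e)
        ... | inj₁ plo≡hi = ⊥-elim (plo≢hi plo≡hi)
        ... | inj₂ phi≡lo = inj₂ refl , inj₁ phi≡lo , proj₁ (parent≡⇒child (~-sym (lo~hi e)) phi≡lo)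

      lowerEnd≢root : ∀ e → lowerEnd e ≢ r
      lowerEnd≢root e = proj₂ (proj₂ (lowerEnd-spec e))

      ∈ₑ-lowerEnd⁻ : ∀ {w e} → w ∈ₑ e → w ≡ lowerEnd e ⊎ w ≡ parent (lowerEnd e)
      ∈ₑ-lowerEnd⁻ {e = e} = ∈ₑ-endpoints {e = e} (proj₁ (lowerEnd-spec e)) (proj₁ (proj₂ (lowerEnd-spec e)))
                                          (~-irrefl (~-parent (lowerEnd≢root e)))

      ∉ₑ-lowerEnd : ∀ {v e c} → lowerEnd e ≡ c → v ≢ c → v ≢ parent c → ¬ v ∈ₑ e
      ∉ₑ-lowerEnd le≡c v≢c v≢pc v∈e with ∈ₑ-lowerEnd⁻ v∈e
      ... | inj₁ v≡l = v≢c (trans v≡l le≡c)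
      ... | inj₂ v≡pl = v≢pc (trans v≡pl (cong parent le≡c))

      lowerEnd-injective : ∀ {e f} → lowerEnd e ≡ lowerEnd f → e ≡ f
      lowerEnd-injective {e} {f} eq = edge-determined (~-irrefl (~-parent (lowerEnd≢root e)))
        (proj₁ (lowerEnd-spec e)) (proj₁ (proj₂ (lowerEnd-spec e)))
        (subst (_∈ₑ f) (sym eq) (proj₁ (lowerEnd-spec f)))
        (subst (λ z → parent z ∈ₑ f) (sym eq) (proj₁ (proj₂ (lowerEnd-spec f))))

      lowerEnd-parentEdge : ∀ {c} (c≢r : c ≢ r) → lowerEnd (parentEdge c≢r) ≡ c
      lowerEnd-parentEdge {c} c≢r
        with ∈ₑ-lowerEnd⁻ (∈ₑ-edgeˡ c (parent c) (~-parent c≢r))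
           | ∈ₑ-lowerEnd⁻ (∈ₑ-edgeʳ c (parent c) (~-parent c≢r))
      ... | inj₁ c≡l | _ = sym c≡l
      ... | inj₂ c≡pl | inj₁ pc≡l = ⊥-elim (c≢r (parent-parent≡⇒root (trans (cong parent pc≡l) (sym c≡pl))))
      ... | inj₂ c≡pl | inj₂ pc≡pl = ⊥-elim (~-irrefl (~-parent c≢r) (trans c≡pl (sym pc≡pl)))

module TotalDominatorColourings {n : ℕ} (G : SimpleGraph n) {m : ℕ} (size : HasSize G m) where
  open Graph G
  open Inverse size using (to; from; strictlyInverseˡ; strictlyInverseʳ)

  H : CVertex G → CVertex G → Set
  H = CompCAdj G

  to-injective : ∀ {e f} → to e ≡ to f → e ≡ f
  to-injective {e} {f} eq = trans (sym (strictlyInverseʳ e)) (trans (cong from eq) (strictlyInverseʳ f))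

  _≟ₑ_ : ∀ (e f : E) → Dec (e ≡ f)
  e ≟ₑ f with to e ≟ᶠ to f
  ... | yes eq = yes (to-injective eq)
  ... | no ne = no (ne ∘ cong to)

  module _ {j} (T : TDC H j) where
    open TDC T

    edgeColour-injective : ∀ {e f} → col (inj₂ e) ≡ col (inj₂ f) → e ≡ f
    edgeColour-injective {e} {f} eq with e ≟ₑ f
    ... | yes e≡f = e≡f
    ... | no e≢f = ⊥-elim (proper _ _ (≢⇒complᵉᵉ e≢f) eq)

    size≤colours : m ≤ j
    size≤colours = injective⇒≤ λ {k} {k′} eq →
      trans (sym (strictlyInverseˡ k)) (trans (cong to (edgeColour-injective eq)) (strictlyInverseˡ k′))

    -- Properness forces v ∈ e for the partner e of v, and two G-neighbours with the same
    -- partner would be H-adjacent vertices of the same colour.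
    sharedColours⇒orientation : (∀ v → Σ E λ e → col (inj₂ e) ≡ col (inj₁ v)) → FunctionalOrientation
    sharedColours⇒orientation shared = record { out = out ; ~-out = ~-out ; out-out≢ = out-out≢ }
      where
      partner : V → E
      partner v = proj₁ (shared v)
      ∈ₑ-partner : ∀ v → v ∈ₑ partner v
      ∈ₑ-partner v with v ∈ₑ? partner v
      ... | yes v∈e = v∈e
      ... | no v∉e = ⊥-elim (proper _ _ (∉⇒complᵛᵉ v∉e) (sym (proj₂ (shared v))))
      out : V → V
      out v = opposite v (partner v)
      ~-out : ∀ v → v ~ out v
      ~-out v = ~-opposite (∈ₑ-partner v)
      out-out≢ : ∀ v → out (out v) ≢ v
      out-out≢ v oov≡v = proper _ _ (~⇒compl (~-out v))
        (trans (sym (proj₂ (shared v))) (trans (cong (col ∘ inj₂) same-partner) (proj₂ (shared (out v)))))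
        where
        same-partner : partner v ≡ partner (out v)
        same-partner = edge-determined (~-irrefl (~-out v)) (∈ₑ-partner v) (opposite-∈ₑ v (partner v))
          (subst (_∈ₑ partner (out v)) oov≡v (opposite-∈ₑ (out v) (partner (out v)))) (∈ₑ-partner (out v))

    unsharedColour⇒order≤colours : ∀ {r} → Rooting r →
                                   ∀ v₀ → (∀ e → col (inj₂ e) ≢ col (inj₁ v₀)) → n ≤ j
    unsharedColour⇒order≤colours {r} R v₀ unshared = injective⇒≤ λ {v} {w} → h-injective (v ≟ᶠ r) (w ≟ᶠ r)
      where
      open Rooted R
      h : ∀ {v} → Dec (v ≡ r) → Fin j
      h (yes _) = col (inj₁ v₀)
      h (no v≢r) = col (inj₂ (parentEdge v≢r))
      h-injective : ∀ {v w} (v≟r : Dec (v ≡ r)) (w≟r : Dec (w ≡ r)) → h v≟r ≡ h w≟r → v ≡ w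
      h-injective (yes v≡r) (yes w≡r) _ = trans v≡r (sym w≡r)
      h-injective (yes _) (no w≢r) eq = ⊥-elim (unshared _ (sym eq))
      h-injective (no v≢r) (yes _) eq = ⊥-elim (unshared _ eq)
      h-injective (no v≢r) (no w≢r) eq = parentEdge-injective v≢r w≢r (edgeColour-injective eq)

    acyclic⇒order≤colours : ∀ {r} → Rooting r → Acyclic G → n ≤ j
    acyclic⇒order≤colours {r} R acyclic with all? (λ v → any? (λ k → col (inj₂ (from k)) ≟ᶠ col (inj₁ v)))
    ... | yes shared = ⊥-elim (acyclic _ (proj₂ (orientation⇒cycle r
            (sharedColours⇒orientation λ v → from (proj₁ (shared v)) , proj₂ (shared v)))))
    ... | no ¬shared with ¬∀⟶∃¬ n _ (λ v → any? (λ k → col (inj₂ (from k)) ≟ᶠ col (inj₁ v))) ¬shared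
    ... | v₀ , unshared = unsharedColour⇒order≤colours R v₀ λ e eq →
            unshared (to e , trans (cong (col ∘ inj₂) (strictlyInverseʳ e)) eq)

  module _ (O : FunctionalOrientation) where
    open FunctionalOrientation O

    outEdge : V → E
    outEdge v = edge v (out v) (~-out v)

    ∈ₑ-outEdge : ∀ v → v ∈ₑ outEdge v
    ∈ₑ-outEdge v = ∈ₑ-edgeˡ v (out v) (~-out v)

    outEdge-injective : ∀ {v w} → outEdge v ≡ outEdge w → v ≡ w
    outEdge-injective {v} {w} eq with edge-≡⁻ (~-out v) (~-out w) eq
    ... | inj₁ v≡w = v≡w
    ... | inj₂ (v≡ow , ov≡w) = ⊥-elim (out-out≢ w (trans (cong out (sym v≡ow)) ov≡w))

    ∉ₑ-outEdge-out : ∀ v → ¬ v ∈ₑ outEdge (out v)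
    ∉ₑ-outEdge-out v v∈ with ∈ₑ-edge⁻ (~-out (out v)) v∈
    ... | inj₁ v≡ov = ~-irrefl (~-out v) v≡ov
    ... | inj₂ v≡oov = out-out≢ v (sym v≡oov)

    orientationColouring : 2 < n → TDC H m
    orientationColouring 2<n = record
      { col = col ; onto = λ k → inj₂ (from k) , strictlyInverseˡ k ; proper = proper ; dominate = dominate }
      where
      col : CVertex G → Fin m
      col (inj₁ v) = to (outEdge v)
      col (inj₂ e) = to e
      proper : ∀ a b → H a b → col a ≢ col b
      proper (inj₁ v) (inj₁ w) (a≢b , _) eq = a≢b (cong inj₁ (outEdge-injective (to-injective eq)))
      proper (inj₁ v) (inj₂ e) (_ , ¬cadj) eq = ¬cadj (subst (v ∈ₑ_) (to-injective eq) (∈ₑ-outEdge v))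
      proper (inj₂ e) (inj₁ v) (_ , ¬cadj) eq = ¬cadj (subst (v ∈ₑ_) (sym (to-injective eq)) (∈ₑ-outEdge v))
      proper (inj₂ e) (inj₂ f) (a≢b , _) eq = a≢b (cong inj₂ (to-injective eq))
      dominate : ∀ a → ∃ λ (k : Fin m) → ∀ b → col b ≡ k → H a b
      dominate (inj₁ v) = to (outEdge (out v)) , λ
        { (inj₁ w) eq → subst (H (inj₁ v) ∘ inj₁) (sym (outEdge-injective (to-injective eq))) (~⇒compl (~-out v))
        ; (inj₂ e) eq → ∉⇒complᵛᵉ (∉ₑ-outEdge-out v ∘ subst (v ∈ₑ_) (to-injective eq)) }
      dominate (inj₂ e) with avoid₂ 2<n (lo e) (hi e)
      ... | u , u≢lo , u≢hi = to (outEdge u) , λ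
        { (inj₁ w) eq → subst (H (inj₂ e) ∘ inj₁) (sym (outEdge-injective (to-injective eq))) (∉⇒complᵉᵛ u∉e)
        ; (inj₂ f) eq → ≢⇒complᵉᵉ λ e≡f →
                          u∉e (subst (u ∈ₑ_) (sym (trans e≡f (to-injective eq))) (∈ₑ-outEdge u)) }
        where
        u∉e : ¬ u ∈ₑ e
        u∉e (inj₁ u≡lo) = u≢lo u≡lo
        u∉e (inj₂ u≡hi) = u≢hi u≡hi

  -- Colours are vertices: c_e gets the lower end of e, every vertex its own name except the
  -- grandchild x of the root, which joins the class of r (the class {c_e(x)} then dominates r).
  module TreeColouring {r : V} (R : Rooting r) (tree : ∀ u v → u ~ v → Rooted.TreeEdge R u v)
                       {x : V} (px≢r : Rooting.parent R x ≢ r) (ppx≡r : Rooting.parent R (Rooting.parent R x) ≡ r)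
                       (3<n : 3 < n) where
    open Rooting R
    open Rooted R

    px : V
    px = parent x

    x≢r : x ≢ r
    x≢r x≡r = px≢r (trans (cong parent x≡r) parent-root)

    x~px : x ~ px
    x~px = ~-parent x≢r

    px~r : px ~ r
    px~r = subst (px ~_) ppx≡r (~-parent px≢r)

    x≁r : ¬ x ~ r
    x≁r x~r with tree x r x~r
    ... | inj₁ px≡r = px≢r px≡r
    ... | inj₂ pr≡x = x≢r (trans (sym pr≡x) parent-root)

    colourOf : ∀ {v} → Dec (v ≡ x) → V
    colourOf (yes _) = r
    colourOf {v} (no _) = v

    col : CVertex G → V
    col (inj₁ v) = colourOf (v ≟ᶠ x)
    col (inj₂ e) = lowerEnd tree e

    vertexColour : ∀ v → (v ≢ x × col (inj₁ v) ≡ v) ⊎ (v ≡ x × col (inj₁ v) ≡ r)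
    vertexColour v = cases (v ≟ᶠ x)
      where
      cases : (v≟x : Dec (v ≡ x)) → (v ≢ x × colourOf v≟x ≡ v) ⊎ (v ≡ x × colourOf v≟x ≡ r)
      cases (yes v≡x) = inj₂ (v≡x , refl)
      cases (no v≢x) = inj₁ (v≢x , refl)

    vertexColour≢x : ∀ v → col (inj₁ v) ≢ x
    vertexColour≢x v eq with vertexColour v
    ... | inj₁ (v≢x , cv) = v≢x (trans (sym cv) eq)
    ... | inj₂ (_ , cv) = x≢r (trans (sym eq) cv)

    onto : ∀ k → ∃ λ a → col a ≡ k
    onto k with vertexColour k
    ... | inj₁ (_ , ck) = inj₁ k , ck
    ... | inj₂ (refl , _) = inj₂ (parentEdge x≢r) , lowerEnd-parentEdge tree x≢r

    proper : ∀ a b → H a b → col a ≢ col b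
    proper (inj₁ v) (inj₁ w) adj eq with vertexColour v | vertexColour w
    ... | inj₁ (_ , cv) | inj₁ (_ , cw) = proj₁ adj (cong inj₁ (trans (sym cv) (trans eq cw)))
    ... | inj₂ (v≡x , _) | inj₂ (w≡x , _) = proj₁ adj (cong inj₁ (trans v≡x (sym w≡x)))
    ... | inj₂ (refl , cx) | inj₁ (_ , cw) = x≁r (subst (x ~_) (trans (sym cw) (trans (sym eq) cx)) (compl⇒~ adj))
    ... | inj₁ (_ , cv) | inj₂ (refl , cx) = x≁r (~-sym (subst (_~ x) (trans (sym cv) (trans eq cx)) (compl⇒~ adj)))
    proper (inj₁ v) (inj₂ e) (_ , ¬cadj) eq with vertexColour v
    ... | inj₁ (_ , cv) = ¬cadj (subst (_∈ₑ e) (trans (sym eq) cv) (proj₁ (lowerEnd-spec tree e)))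
    ... | inj₂ (_ , cv) = lowerEnd≢root tree e (trans (sym eq) cv)
    proper (inj₂ e) (inj₁ v) (_ , ¬cadj) eq with vertexColour v
    ... | inj₁ (_ , cv) = ¬cadj (subst (_∈ₑ e) (trans eq cv) (proj₁ (lowerEnd-spec tree e)))
    ... | inj₂ (_ , cv) = lowerEnd≢root tree e (trans eq cv)
    proper (inj₂ e) (inj₂ f) (a≢b , _) eq = a≢b (cong inj₂ (lowerEnd-injective tree eq))

    vertexColour≡ : ∀ {w k} → col (inj₁ w) ≡ k → k ≢ r → w ≡ k
    vertexColour≡ {w} eq k≢r with vertexColour w
    ... | inj₁ (_ , cw) = trans (sym cw) eq
    ... | inj₂ (_ , cw) = ⊥-elim (k≢r (trans (sym eq) cw))

    Dominated : CVertex G → Set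
    Dominated a = ∃ λ k → ∀ b → col b ≡ k → H a b

    x-dominated : Dominated (inj₁ x)
    x-dominated = px , λ
      { (inj₁ w) eq → subst (H (inj₁ x) ∘ inj₁) (sym (vertexColour≡ eq px≢r)) (~⇒compl x~px)
      ; (inj₂ e) eq → ∉⇒complᵛᵉ (∉ₑ-lowerEnd tree eq (~-irrefl x~px) (λ x≡ppx → x≢r (trans x≡ppx ppx≡r))) }

    px-dominated : Dominated (inj₁ px)
    px-dominated = r , λ
      { (inj₁ w) eq → ~⇒compl (px~ w eq)
      ; (inj₂ e) eq → ⊥-elim (lowerEnd≢root tree e eq) }
      where
      px~ : ∀ w → col (inj₁ w) ≡ r → px ~ w
      px~ w eq with vertexColour w
      ... | inj₁ (_ , cw) = subst (px ~_) (trans (sym eq) cw) px~r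
      ... | inj₂ (w≡x , _) = subst (px ~_) (sym w≡x) (~-sym x~px)

    other-dominated : ∀ {v} → v ≢ x → v ≢ px → Dominated (inj₁ v)
    other-dominated v≢x v≢px = x , λ
      { (inj₁ w) eq → ⊥-elim (vertexColour≢x w eq)
      ; (inj₂ e) eq → ∉⇒complᵛᵉ (∉ₑ-lowerEnd tree eq v≢x v≢px) }

    xEdge-dominated : ∀ {e} → lowerEnd tree e ≡ x → Dominated (inj₂ e)
    xEdge-dominated {e} le≡x with avoid₃ 3<n r x px
    ... | z , z≢r , z≢x , z≢px = z , λ
      { (inj₁ w) eq → subst (H (inj₂ e) ∘ inj₁) (sym (vertexColour≡ eq z≢r))
                            (∉⇒complᵉᵛ (∉ₑ-lowerEnd tree le≡x z≢x z≢px))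
      ; (inj₂ f) eq → ≢⇒complᵉᵉ λ e≡f → z≢x (trans (sym eq) (trans (cong (lowerEnd tree) (sym e≡f)) le≡x)) }

    otherEdge-dominated : ∀ {e} → lowerEnd tree e ≢ x → Dominated (inj₂ e)
    otherEdge-dominated le≢x = x , λ
      { (inj₁ w) eq → ⊥-elim (vertexColour≢x w eq)
      ; (inj₂ f) eq → ≢⇒complᵉᵉ λ e≡f → le≢x (trans (cong (lowerEnd tree) e≡f) eq) }

    dominate : ∀ a → Dominated a
    dominate (inj₁ v) with v ≟ᶠ x | v ≟ᶠ px
    ... | yes refl | _ = x-dominated
    ... | no _ | yes refl = px-dominated
    ... | no v≢x | no v≢px = other-dominated v≢x v≢px
    dominate (inj₂ e) with lowerEnd tree e ≟ᶠ x
    ... | yes le≡x = xEdge-dominated le≡x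
    ... | no le≢x = otherEdge-dominated le≢x

    treeColouring : TDC H n
    treeColouring = record { col = col ; onto = onto ; proper = proper ; dominate = dominate }

  treeChromatic : Connected G → Acyclic G → 3 < n → TDChromatic H n
  treeChromatic conn acyclic 3<n with nonAdjacentPair (<⇒≤ 3<n) acyclic
  ... | r , w , r≢w , r≁w =
    colouring (Rooted.grandchild R (r≢w ∘ sym) (r≁w ∘ ~-sym)) ,
    λ j j<n T → <⇒≱ j<n (acyclic⇒order≤colours T R acyclic)
    where
    R : Rooting r
    R = breadthFirstRooting conn r
    colouring : (Σ V λ x → Rooting.parent R x ≢ r × Rooting.parent R (Rooting.parent R x) ≡ r) → TDC H n
    colouring (x , px≢r , ppx≡r) =
      TreeColouring.treeColouring R (Rooted.acyclic⇒treeEdges R acyclic) {x} px≢r ppx≡r 3<n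

  nonTreeChromatic : Connected G → ¬ Acyclic G → 2 < n → TDChromatic H m
  nonTreeChromatic conn ¬acyclic 2<n@(s≤s _) =
    orientationColouring (Rooted.¬acyclic⇒orientation (breadthFirstRooting conn zero) ¬acyclic) 2<n ,
    λ j j<m T → <⇒≱ j<m (size≤colours T)

theorem4p2 : ∀ (n m : ℕ) (G : SimpleGraph n) → 4 ≤ n → Connected G → HasSize G m →
    (IsTree G → TDChromatic (CompCAdj G) n) × (¬ IsTree G → TDChromatic (CompCAdj G) m)
theorem4p2 n m G 4≤n conn size =
  (λ (_ , acyclic) → treeChromatic conn acyclic 4≤n) ,
  (λ ¬tree → nonTreeChromatic conn (λ acyclic → ¬tree (conn , acyclic)) (<⇒≤ 4≤n))
  where open TotalDominatorColourings G size
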